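{- For any integer $k\geq 1$, the mappings $g\colon L_{2k,k}\setminus D_{2k}^k\to L_{2k,k+1}$ and $h'\colon L_{2k,k+1}\to L_{2k,k}\setminus D_{2k}^k$ are bijections, and $g^{ -1}=h'$.
   Context: A lattice path with $n$ steps is a sequence $x=(x_1,\ldots,x_n)$ of steps, each either an up-step $(1,1)$ or a down-step $(1,-1)$, drawn in $\mathbb{Z}^2$ starting at the origin; step $x_i$ goes from $(i-1,h_{i-1})$ to $(i,h_i)$. A step lies below the line $y=c$ if both of its endpoints have $y$-coordinate at most $c$. A step touches the line $y=c$ if it starts or ends on that line. For $c\in\mathbb{Z}$, $u_c(x)$ and $d_c(x)$ denote the number of up-steps, respectively down-steps, of $x$ that start on the line $y=c$. Let $L_{2k,k}$ (resp. $L_{2k,k+1}$) be the set of lattice paths with $2k$ steps of which exactly $k$ (resp. $k+1$) are up-steps. For $e\in\{0,\ldots,k\}$, $D_{2k}^e$ is the set of paths in $L_{2k,k}$ having exactly $e$ down-steps below the line $y=0$. For $x\in L_{2k,k}\setminus D_{2k}^k$, $g(x)$ is obtained from $x$ by replacing by an up-step the $(d_0(x)+1)$-th (from the left) down-step of $x$ touching the line $y=0$. For $x\in L_{2k,k+1}$, $h'(x)$ is obtained from $x$ by replacing by a down-step the $(u_1(x)+1)$-th (from the left) up-step of $x$ touching the line $y=1$. -}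

module Defs where

open import Data.Bool using (Bool; true; false; not; _∧_; _∨_; if_then_else_)
open import Data.Nat using (ℕ; zero; suc)
import Data.Nat as ℕ
open import Data.Integer using (ℤ; +_; _+_; _-_; -[1+_])
import Data.Integer as ℤ
open import Data.Vec using (Vec; []; _∷_)
open import Data.Product using (_×_)
open import Relation.Binary.PropositionalEquality using (_≡_)
open import Relation.Nullary using (¬_)
open import Relation.Nullary.Decidable using (⌊_⌋)

-- A lattice path with n steps: true = up-step (1,1), false = down-step (1,-1).
-- Paths start at the origin (height 0).
Path : ℕ → Set
Path n = Vec Bool n

δ : Bool → ℤ
δ true  = + 1
δ false = -[1+ 0 ]

endH : ℤ → Bool → ℤ
endH h s = h + δ s

_==_ : ℤ → ℤ → Bool
a == b = ⌊ a ℤ.≟ b ⌋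

_≤ᵇ_ : ℤ → ℤ → Bool
a ≤ᵇ b = ⌊ a ℤ.≤? b ⌋

ups : ∀ {n} → Path n → ℕ
ups [] = 0
ups (true ∷ xs) = suc (ups xs)
ups (false ∷ xs) = ups xs

countFrom : ∀ {n} → (ℤ → Bool → Bool) → ℤ → Path n → ℕ
countFrom P h [] = 0
countFrom P h (s ∷ xs) with P h s
... | true  = suc (countFrom P (endH h s) xs)
... | false = countFrom P (endH h s) xs

u : ∀ {n} → ℤ → Path n → ℕ
u c = countFrom (λ h s → s ∧ (h == c)) (+ 0)

d : ∀ {n} → ℤ → Path n → ℕ
d c = countFrom (λ h s → not s ∧ (h == c)) (+ 0)

below : ℤ → ℤ → Bool → Bool
below c h s = (h ≤ᵇ c) ∧ (endH h s ≤ᵇ c)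

touches : ℤ → ℤ → Bool → Bool
touches c h s = (h == c) ∨ (endH h s == c)

downsBelow0 : ∀ {n} → Path n → ℕ
downsBelow0 = countFrom (λ h s → not s ∧ below (+ 0) h s) (+ 0)

L : (n m : ℕ) → Path n → Set
L n m x = ups x ≡ m

D : (k e : ℕ) → Path (k ℕ.+ k) → Set
D k e x = L (k ℕ.+ k) k x × downsBelow0 x ≡ e

-- replace the (j+1)-th (from the left) step satisfying P by the opposite step
-- (path assumed to start at height h); unchanged if there is no such step
flipNth : ∀ {n} → (ℤ → Bool → Bool) → ℕ → ℤ → Path n → Path n
flipNth P j h [] = []
flipNth P j h (s ∷ xs) with P h s | j
... | true  | zero  = not s ∷ xs
... | true  | suc j' = s ∷ flipNth P j' (endH h s) xs
... | false | _     = s ∷ flipNth P j (endH h s) xs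

g : ∀ {n} → Path n → Path n
g x = flipNth (λ h s → not s ∧ touches (+ 0) h s) (d (+ 0) x) (+ 0) x

h′ : ∀ {n} → Path n → Path n
h′ x = flipNth (λ h s → s ∧ touches (+ 1) h s) (u (+ 1) x) (+ 0) x

-- g turns a down-step touching y = 0 (starting at height 0 or 1) into an up-step touching
-- y = 1, and h′ does the converse, so it suffices to show that each map flips exactly the step
-- the other one created. Before the flipped step the path is unchanged; after it, the path is
-- raised (or lowered) by 2, which turns crossings of the levels −1|0 into crossings of 1|2.
-- Balancing the crossings of 0|1 before the step and of −1|0 after it shows that, when x ends
-- at height 0, exactly u₁(g x) up-steps touching y = 1 precede the step flipped by g;
-- symmetrically for h′ on paths ending at height 2. The required
-- steps exist because a path in L_{2k,k} ∖ D has a down-step starting at height 1, and a path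
-- ending at height 2 has an up-step starting at height 0.

module Submission where

open import Defs
open import Data.Bool using (Bool; true; false; not; _∧_; if_then_else_)
open import Data.Bool.Properties using (not-involutive)
open import Data.Nat using (ℕ; zero; suc; _+_; _≤_; _<_; s≤s; z≤n)
open import Data.Nat.Properties
open import Data.Integer using (ℤ; +_; -[1+_])
import Data.Integer as ℤ
import Data.Integer.Properties as ℤ
import Data.Nat.Tactic.RingSolver as ℕ-Solver
import Data.Integer.Tactic.RingSolver as ℤ-Solver
open import Algebra.Properties.AbelianGroup ℤ.+-0-abelianGroup using (∙-cancelˡ; ∙-cancelʳ)
open import Data.Vec using ([]; _∷_)
open import Data.Product using (_×_; _,_)
open import Data.Empty using (⊥-elim)
open import Relation.Nullary using (¬_; yes; no)
open import Relation.Binary.PropositionalEquality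

𝟙 : Bool → ℕ
𝟙 true  = 1
𝟙 false = 0

countBefore : ∀ {n} → (ℤ → Bool → Bool) → (ℤ → Bool → Bool) → ℕ → ℤ → Path n → ℕ
countBefore P Q j h [] = 0
countBefore P Q j h (s ∷ xs) with P h s | j
... | true  | zero   = 0
... | true  | suc j′ = 𝟙 (Q h s) + countBefore P Q j′ (endH h s) xs
... | false | _      = 𝟙 (Q h s) + countBefore P Q j (endH h s) xs

ups-flipNth-down : ∀ {n} P → (∀ h → P h true ≡ false) →
  ∀ j h (xs : Path n) → j < countFrom P h xs → ups (flipNth P j h xs) ≡ suc (ups xs)
ups-flipNth-down P onlyDown j h (true ∷ xs) lt rewrite onlyDown h =
  cong suc (ups-flipNth-down P onlyDown j _ xs lt)
ups-flipNth-down P onlyDown j h (false ∷ xs) lt with P h false | j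
... | true  | zero   = refl
... | true  | suc j′ = ups-flipNth-down P onlyDown j′ _ xs (≤-pred lt)
... | false | j′     = ups-flipNth-down P onlyDown j′ _ xs lt

ups-flipNth-up : ∀ {n} P → (∀ h → P h false ≡ false) →
  ∀ j h (xs : Path n) → j < countFrom P h xs → suc (ups (flipNth P j h xs)) ≡ ups xs
ups-flipNth-up P onlyUp j h (false ∷ xs) lt rewrite onlyUp h =
  ups-flipNth-up P onlyUp j _ xs lt
ups-flipNth-up P onlyUp j h (true ∷ xs) lt with P h true | j
... | true  | zero   = refl
... | true  | suc j′ = cong suc (ups-flipNth-up P onlyUp j′ _ xs (≤-pred lt))
... | false | j′     = cong suc (ups-flipNth-up P onlyUp j′ _ xs lt)

flipNth-beyond : ∀ {n} P j h (xs : Path n) → countFrom P h xs ≤ j → flipNth P j h xs ≡ xs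
flipNth-beyond P j h [] _ = refl
flipNth-beyond P j h (s ∷ xs) le with P h s | j
flipNth-beyond P j h (s ∷ xs) () | true | zero
... | true  | suc j′ = cong (s ∷_) (flipNth-beyond P j′ _ xs (≤-pred le))
... | false | j′     = cong (s ∷_) (flipNth-beyond P j′ _ xs le)

flipNth-inverse : ∀ {n} P Q → (∀ h s → P h s ≡ true → Q h (not s) ≡ true) →
  ∀ j h (xs : Path n) → j < countFrom P h xs →
  flipNth Q (countBefore P Q j h xs) h (flipNth P j h xs) ≡ xs
flipNth-inverse P Q P⇒Q j h (s ∷ xs) lt with P h s in Phs | j
... | true | zero with Q h (not s) | P⇒Q h s Phs
...   | true | refl = cong (_∷ xs) (not-involutive s)
flipNth-inverse P Q P⇒Q j h (s ∷ xs) lt | true | suc j′ with Q h s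
...   | true  = cong (s ∷_) (flipNth-inverse P Q P⇒Q j′ _ xs (≤-pred lt))
...   | false = cong (s ∷_) (flipNth-inverse P Q P⇒Q j′ _ xs (≤-pred lt))
flipNth-inverse P Q P⇒Q j h (s ∷ xs) lt | false | j′ with Q h s
...   | true  = cong (s ∷_) (flipNth-inverse P Q P⇒Q j′ _ xs lt)
...   | false = cong (s ∷_) (flipNth-inverse P Q P⇒Q j′ _ xs lt)

downs : ∀ {n} → Path n → ℕ
downs []           = 0
downs (true ∷ xs)  = downs xs
downs (false ∷ xs) = suc (downs xs)

ups+downs≡length : ∀ {n} (xs : Path n) → ups xs + downs xs ≡ n
ups+downs≡length []           = refl
ups+downs≡length (true ∷ xs)  = cong suc (ups+downs≡length xs)
ups+downs≡length (false ∷ xs) = trans (+-suc _ _) (cong suc (ups+downs≡length xs))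

endHeight : ∀ {n} → ℤ → Path n → ℤ
endHeight h []       = h
endHeight h (s ∷ xs) = endHeight (endH h s) xs

endHeight+downs≡start+ups : ∀ {n} h (xs : Path n) →
  endHeight h xs ℤ.+ + downs xs ≡ h ℤ.+ + ups xs
endHeight+downs≡start+ups h [] = refl
endHeight+downs≡start+ups h (true ∷ xs) =
  trans (endHeight+downs≡start+ups (h ℤ.+ + 1) xs) (ℤ.+-assoc h (+ 1) (+ ups xs))
endHeight+downs≡start+ups h (false ∷ xs) = begin
  endHeight h₋ xs ℤ.+ (+ 1 ℤ.+ + downs xs)
    ≡⟨ cong (λ z → endHeight h₋ xs ℤ.+ z) (ℤ.+-comm (+ 1) (+ downs xs)) ⟩
  endHeight h₋ xs ℤ.+ (+ downs xs ℤ.+ + 1)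
    ≡⟨ ℤ.+-assoc (endHeight h₋ xs) (+ downs xs) (+ 1) ⟨
  endHeight h₋ xs ℤ.+ + downs xs ℤ.+ + 1
    ≡⟨ cong (λ z → z ℤ.+ + 1) (endHeight+downs≡start+ups h₋ xs) ⟩
  h₋ ℤ.+ + ups xs ℤ.+ + 1
    ≡⟨ down-then-up h (+ ups xs) ⟩
  h ℤ.+ + ups xs ∎
  where
  open ≡-Reasoning
  h₋ = h ℤ.+ -[1+ 0 ]
  down-then-up : ∀ a b → a ℤ.+ ℤ.- + 1 ℤ.+ b ℤ.+ + 1 ≡ a ℤ.+ b
  down-then-up = ℤ-Solver.solve-∀

endHeight-balanced : ∀ {n} e (xs : Path n) → ups xs ≡ e + downs xs → endHeight (+ 0) xs ≡ + e
endHeight-balanced e xs ups≡e+downs = ∙-cancelʳ (+ downs xs) _ _ (begin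
  endHeight (+ 0) xs ℤ.+ + downs xs  ≡⟨ endHeight+downs≡start+ups (+ 0) xs ⟩
  + ups xs                           ≡⟨ cong +_ ups≡e+downs ⟩
  + (e + downs xs)                   ≡⟨ ℤ.pos-+ e (downs xs) ⟩
  + e ℤ.+ + downs xs                 ∎)
  where open ≡-Reasoning

==-translate : ∀ t h c → ((t ℤ.+ h) == (t ℤ.+ c)) ≡ (h == c)
==-translate t h c with h ℤ.≟ c | t ℤ.+ h ℤ.≟ t ℤ.+ c
... | yes _   | yes _       = refl
... | no _    | no _        = refl
... | yes h≡c | no t+h≢t+c = ⊥-elim (t+h≢t+c (cong (ℤ._+_ t) h≡c))
... | no h≢c  | yes t+h≡t+c = ⊥-elim (h≢c (∙-cancelˡ t h c t+h≡t+c))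

countFrom-translate : ∀ {n} P Q t → (∀ h s → P (t ℤ.+ h) s ≡ Q h s) →
  ∀ h (xs : Path n) → countFrom P (t ℤ.+ h) xs ≡ countFrom Q h xs
countFrom-translate P Q t P≡Q h [] = refl
countFrom-translate P Q t P≡Q h (s ∷ xs) rewrite P≡Q h s with Q h s
... | true  rewrite ℤ.+-assoc t h (δ s) = cong suc (countFrom-translate P Q t P≡Q (endH h s) xs)
... | false rewrite ℤ.+-assoc t h (δ s) = countFrom-translate P Q t P≡Q (endH h s) xs

endHeight-translate : ∀ {n} t h (xs : Path n) → endHeight (t ℤ.+ h) xs ≡ t ℤ.+ endHeight h xs
endHeight-translate t h [] = refl
endHeight-translate t h (s ∷ xs) rewrite ℤ.+-assoc t h (δ s) = endHeight-translate t (endH h s) xs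

upsAt downsAt downsBelow : ∀ {n} → ℤ → ℤ → Path n → ℕ
upsAt c      = countFrom (λ h s → s ∧ (h == c))
downsAt c    = countFrom (λ h s → not s ∧ (h == c))
downsBelow c = countFrom (λ h s → not s ∧ below c h s)

downTouching₀ upTouching₁ : ℤ → Bool → Bool
downTouching₀ h s = not s ∧ touches (+ 0) h s
upTouching₁ h s   = s ∧ touches (+ 1) h s

𝟙[_≤_] : ℤ → ℤ → ℕ
𝟙[ c ≤ h ] = if c ≤ᵇ h then 1 else 0

crossing₀₁ : ∀ {n} h (xs : Path n) →
  𝟙[ + 1 ≤ h ] + upsAt (+ 0) h xs ≡ downsAt (+ 1) h xs + 𝟙[ + 1 ≤ endHeight h xs ]
crossing₀₁ h [] = +-comm 𝟙[ + 1 ≤ h ] 0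
crossing₀₁ (+ 0)             (true  ∷ xs) = crossing₀₁ _ xs
crossing₀₁ (+ 0)             (false ∷ xs) = crossing₀₁ _ xs
crossing₀₁ (+ 1)             (true  ∷ xs) = crossing₀₁ _ xs
crossing₀₁ (+ 1)             (false ∷ xs) = cong suc (crossing₀₁ _ xs)
crossing₀₁ (+ suc (suc _))   (true  ∷ xs) = crossing₀₁ _ xs
crossing₀₁ (+ suc (suc _))   (false ∷ xs) = crossing₀₁ _ xs
crossing₀₁ -[1+ 0 ]          (true  ∷ xs) = crossing₀₁ _ xs
crossing₀₁ -[1+ suc _ ]      (true  ∷ xs) = crossing₀₁ _ xs
crossing₀₁ -[1+ 0 ]          (false ∷ xs) = crossing₀₁ _ xs
crossing₀₁ -[1+ suc _ ]      (false ∷ xs) = crossing₀₁ _ xs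

crossing₁₂ : ∀ {n} h (xs : Path n) →
  𝟙[ + 2 ≤ h ] + upsAt (+ 1) h xs ≡ downsAt (+ 2) h xs + 𝟙[ + 2 ≤ endHeight h xs ]
crossing₁₂ h [] = +-comm 𝟙[ + 2 ≤ h ] 0
crossing₁₂ (+ 0)               (true  ∷ xs) = crossing₁₂ _ xs
crossing₁₂ (+ 0)               (false ∷ xs) = crossing₁₂ _ xs
crossing₁₂ (+ 1)               (true  ∷ xs) = crossing₁₂ _ xs
crossing₁₂ (+ 1)               (false ∷ xs) = crossing₁₂ _ xs
crossing₁₂ (+ 2)               (true  ∷ xs) = crossing₁₂ _ xs
crossing₁₂ (+ 2)               (false ∷ xs) = cong suc (crossing₁₂ _ xs)
crossing₁₂ (+ suc (suc (suc _))) (true  ∷ xs) = crossing₁₂ _ xs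
crossing₁₂ (+ suc (suc (suc _))) (false ∷ xs) = crossing₁₂ _ xs
crossing₁₂ -[1+ 0 ]            (true  ∷ xs) = crossing₁₂ _ xs
crossing₁₂ -[1+ suc _ ]        (true  ∷ xs) = crossing₁₂ _ xs
crossing₁₂ -[1+ 0 ]            (false ∷ xs) = crossing₁₂ _ xs
crossing₁₂ -[1+ suc _ ]        (false ∷ xs) = crossing₁₂ _ xs

downTouching₀-split : ∀ {n} h (xs : Path n) →
  countFrom downTouching₀ h xs ≡ downsAt (+ 0) h xs + downsAt (+ 1) h xs
downTouching₀-split h [] = refl
downTouching₀-split (+ 0)           (true  ∷ xs) = downTouching₀-split _ xs
downTouching₀-split (+ 0)           (false ∷ xs) = cong suc (downTouching₀-split _ xs)
downTouching₀-split (+ 1)           (true  ∷ xs) = downTouching₀-split _ xs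
downTouching₀-split (+ 1)           (false ∷ xs) =
  trans (cong suc (downTouching₀-split _ xs)) (sym (+-suc _ _))
downTouching₀-split (+ suc (suc _)) (true  ∷ xs) = downTouching₀-split _ xs
downTouching₀-split (+ suc (suc _)) (false ∷ xs) = downTouching₀-split _ xs
downTouching₀-split -[1+ 0 ]        (true  ∷ xs) = downTouching₀-split _ xs
downTouching₀-split -[1+ suc _ ]    (true  ∷ xs) = downTouching₀-split _ xs
downTouching₀-split -[1+ _ ]        (false ∷ xs) = downTouching₀-split _ xs

upTouching₁-split : ∀ {n} h (xs : Path n) →
  countFrom upTouching₁ h xs ≡ upsAt (+ 0) h xs + upsAt (+ 1) h xs
upTouching₁-split h [] = refl
upTouching₁-split (+ 0)           (true  ∷ xs) = cong suc (upTouching₁-split _ xs)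
upTouching₁-split (+ 0)           (false ∷ xs) = upTouching₁-split _ xs
upTouching₁-split (+ 1)           (true  ∷ xs) =
  trans (cong suc (upTouching₁-split _ xs)) (sym (+-suc _ _))
upTouching₁-split (+ 1)           (false ∷ xs) = upTouching₁-split _ xs
upTouching₁-split (+ suc (suc _)) (true  ∷ xs) = upTouching₁-split _ xs
upTouching₁-split (+ suc (suc _)) (false ∷ xs) = upTouching₁-split _ xs
upTouching₁-split -[1+ 0 ]        (true  ∷ xs) = upTouching₁-split _ xs
upTouching₁-split -[1+ suc _ ]    (true  ∷ xs) = upTouching₁-split _ xs
upTouching₁-split -[1+ _ ]        (false ∷ xs) = upTouching₁-split _ xs

downsBelow₀+downsAt₁≤downs : ∀ {n} h (xs : Path n) →
  downsBelow (+ 0) h xs + downsAt (+ 1) h xs ≤ downs xs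
downsBelow₀+downsAt₁≤downs h [] = z≤n
downsBelow₀+downsAt₁≤downs (+ 0)           (true  ∷ xs) = downsBelow₀+downsAt₁≤downs _ xs
downsBelow₀+downsAt₁≤downs (+ 0)           (false ∷ xs) = s≤s (downsBelow₀+downsAt₁≤downs _ xs)
downsBelow₀+downsAt₁≤downs (+ 1)           (true  ∷ xs) = downsBelow₀+downsAt₁≤downs _ xs
downsBelow₀+downsAt₁≤downs (+ 1)           (false ∷ xs) =
  subst (_≤ suc (downs xs)) (sym (+-suc _ _)) (s≤s (downsBelow₀+downsAt₁≤downs _ xs))
downsBelow₀+downsAt₁≤downs (+ suc (suc _)) (true  ∷ xs) = downsBelow₀+downsAt₁≤downs _ xs
downsBelow₀+downsAt₁≤downs (+ suc (suc _)) (false ∷ xs) = m≤n⇒m≤1+n (downsBelow₀+downsAt₁≤downs _ xs)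
downsBelow₀+downsAt₁≤downs -[1+ 0 ]        (true  ∷ xs) = downsBelow₀+downsAt₁≤downs _ xs
downsBelow₀+downsAt₁≤downs -[1+ suc _ ]    (true  ∷ xs) = downsBelow₀+downsAt₁≤downs _ xs
downsBelow₀+downsAt₁≤downs -[1+ _ ]        (false ∷ xs) = s≤s (downsBelow₀+downsAt₁≤downs _ xs)

downsBelow₀≡downs : ∀ {n} h (xs : Path n) →
  𝟙[ + 1 ≤ h ] ≡ 0 → 𝟙[ + 1 ≤ endHeight h xs ] ≡ 0 → downsAt (+ 1) h xs ≡ 0 →
  downsBelow (+ 0) h xs ≡ downs xs
downsBelow₀≡downs h [] _ _ _ = refl
-- Having climbed to 1, a path ending at height ≤ 0 must step down from 1 again.
downsBelow₀≡downs (+ 0) (true ∷ xs) _ end≤0 noDown₁ =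
  ⊥-elim (1+n≢0 (trans (crossing₀₁ (+ 1) xs) (cong₂ _+_ noDown₁ end≤0)))
downsBelow₀≡downs (+ 0) (false ∷ xs) _ end≤0 noDown₁ =
  cong suc (downsBelow₀≡downs _ xs refl end≤0 noDown₁)
downsBelow₀≡downs -[1+ 0 ] (true ∷ xs) _ end≤0 noDown₁ =
  downsBelow₀≡downs _ xs refl end≤0 noDown₁
downsBelow₀≡downs -[1+ suc _ ] (true ∷ xs) _ end≤0 noDown₁ =
  downsBelow₀≡downs _ xs refl end≤0 noDown₁
downsBelow₀≡downs -[1+ _ ] (false ∷ xs) _ end≤0 noDown₁ =
  cong suc (downsBelow₀≡downs _ xs refl end≤0 noDown₁)

downsAt₂-translate : ∀ {n} h (xs : Path n) → downsAt (+ 2) (+ 2 ℤ.+ h) xs ≡ downsAt (+ 0) h xs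
downsAt₂-translate = countFrom-translate _ _ (+ 2) (λ h s → cong (not s ∧_) (==-translate (+ 2) h (+ 0)))

𝟙[2≤2+h] : ∀ h → 𝟙[ + 2 ≤ + 2 ℤ.+ h ] ≡ 𝟙[ + 0 ≤ h ]
𝟙[2≤2+h] (+ _)              = refl
𝟙[2≤2+h] -[1+ 0 ]           = refl
𝟙[2≤2+h] -[1+ 1 ]           = refl
𝟙[2≤2+h] -[1+ suc (suc _) ] = refl

endHeight-raise₂ : ∀ {n} h (xs : Path n) →
  𝟙[ + 2 ≤ endHeight (+ 2 ℤ.+ h) xs ] ≡ 𝟙[ + 0 ≤ endHeight h xs ]
endHeight-raise₂ h xs =
  trans (cong 𝟙[ + 2 ≤_] (endHeight-translate (+ 2) h xs)) (𝟙[2≤2+h] (endHeight h xs))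

-- The crossings of −1|0 by a path are the crossings of 1|2 by the path raised by 2.
upsAt₁-raise₂ : ∀ {n} h (xs : Path n) →
  𝟙[ + 2 ≤ + 2 ℤ.+ h ] + upsAt (+ 1) (+ 2 ℤ.+ h) xs
    ≡ downsAt (+ 0) h xs + 𝟙[ + 2 ≤ endHeight (+ 2 ℤ.+ h) xs ]
upsAt₁-raise₂ h xs = trans (crossing₁₂ _ xs) (cong₂ _+_ (downsAt₂-translate h xs) refl)

-- At h = 0, j = d₀(x) and end height 0 this says u₁(g x) = countBefore downTouching₀ upTouching₁ j 0 x.
upsAt₁-flipNth-downTouching₀ : ∀ {n} j h (xs : Path n) → j < countFrom downTouching₀ h xs →
  suc (j + upsAt (+ 1) h (flipNth downTouching₀ j h xs))
    ≡ countBefore downTouching₀ upTouching₁ j h xs + downsAt (+ 0) h xs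
      + 𝟙[ + 0 ≤ endHeight h xs ] + 𝟙[ + 1 ≤ h ]
upsAt₁-flipNth-downTouching₀ j (+ 0) (true ∷ xs) lt =
  trans (upsAt₁-flipNth-downTouching₀ j _ xs lt) (+-suc _ 0)
upsAt₁-flipNth-downTouching₀ zero (+ 0) (false ∷ xs) _ =
  cong suc (trans (upsAt₁-raise₂ -[1+ 0 ] xs)
                  (trans (cong₂ _+_ refl (endHeight-raise₂ -[1+ 0 ] xs)) (sym (+-identityʳ _))))
upsAt₁-flipNth-downTouching₀ (suc j) (+ 0) (false ∷ xs) lt =
  trans (cong suc (upsAt₁-flipNth-downTouching₀ j _ xs (≤-pred lt)))
        (cong (λ m → m + 𝟙[ + 0 ≤ endHeight -[1+ 0 ] xs ] + 0) (sym (+-suc _ _)))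
upsAt₁-flipNth-downTouching₀ j (+ 1) (true ∷ xs) lt =
  cong suc (trans (+-suc j _) (upsAt₁-flipNth-downTouching₀ j _ xs lt))
upsAt₁-flipNth-downTouching₀ zero (+ 1) (false ∷ xs) _ =
  trans (cong suc (trans (upsAt₁-raise₂ (+ 0) xs) (cong₂ _+_ refl (endHeight-raise₂ (+ 0) xs))))
        (+-comm 1 _)
upsAt₁-flipNth-downTouching₀ (suc j) (+ 1) (false ∷ xs) lt =
  trans (cong suc (upsAt₁-flipNth-downTouching₀ j _ xs (≤-pred lt))) (sym (+-suc _ 0))
upsAt₁-flipNth-downTouching₀ j (+ suc (suc _)) (true  ∷ xs) lt = upsAt₁-flipNth-downTouching₀ j _ xs lt
upsAt₁-flipNth-downTouching₀ j (+ suc (suc _)) (false ∷ xs) lt = upsAt₁-flipNth-downTouching₀ j _ xs lt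
upsAt₁-flipNth-downTouching₀ j -[1+ 0 ]        (true  ∷ xs) lt = upsAt₁-flipNth-downTouching₀ j _ xs lt
upsAt₁-flipNth-downTouching₀ j -[1+ suc _ ]    (true  ∷ xs) lt = upsAt₁-flipNth-downTouching₀ j _ xs lt
upsAt₁-flipNth-downTouching₀ j -[1+ _ ]        (false ∷ xs) lt = upsAt₁-flipNth-downTouching₀ j _ xs lt

downsAt₀-flipNth-upTouching₁ : ∀ {n} j h (xs : Path n) → j < countFrom upTouching₁ h xs →
  j + downsAt (+ 0) h (flipNth upTouching₁ j h xs) + 𝟙[ + 2 ≤ endHeight h xs ] + 𝟙[ + 1 ≤ h ]
    ≡ suc (countBefore upTouching₁ downTouching₀ j h xs + upsAt (+ 1) h xs)
downsAt₀-flipNth-upTouching₁ zero (+ 0) (true ∷ xs) _ =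
  cong suc (trans (+-identityʳ _) (sym (upsAt₁-raise₂ -[1+ 0 ] xs)))
downsAt₀-flipNth-upTouching₁ (suc j) (+ 0) (true ∷ xs) lt =
  trans (sym (+-suc _ 0)) (downsAt₀-flipNth-upTouching₁ j _ xs (≤-pred lt))
downsAt₀-flipNth-upTouching₁ j (+ 0) (false ∷ xs) lt =
  trans (cong (λ m → m + 𝟙[ + 2 ≤ endHeight -[1+ 0 ] xs ] + 0) (+-suc j _))
        (cong suc (downsAt₀-flipNth-upTouching₁ j _ xs lt))
downsAt₀-flipNth-upTouching₁ zero (+ 1) (true ∷ xs) _ =
  trans (+-comm _ 1) (cong suc (sym (upsAt₁-raise₂ (+ 0) xs)))
downsAt₀-flipNth-upTouching₁ (suc j) (+ 1) (true ∷ xs) lt =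
  cong suc (trans (downsAt₀-flipNth-upTouching₁ j _ xs (≤-pred lt)) (sym (+-suc _ _)))
downsAt₀-flipNth-upTouching₁ j (+ 1) (false ∷ xs) lt =
  trans (+-suc _ 0) (cong suc (downsAt₀-flipNth-upTouching₁ j _ xs lt))
downsAt₀-flipNth-upTouching₁ j (+ suc (suc _)) (true  ∷ xs) lt = downsAt₀-flipNth-upTouching₁ j _ xs lt
downsAt₀-flipNth-upTouching₁ j (+ suc (suc _)) (false ∷ xs) lt = downsAt₀-flipNth-upTouching₁ j _ xs lt
downsAt₀-flipNth-upTouching₁ j -[1+ 0 ]        (true  ∷ xs) lt = downsAt₀-flipNth-upTouching₁ j _ xs lt
downsAt₀-flipNth-upTouching₁ j -[1+ suc _ ]    (true  ∷ xs) lt = downsAt₀-flipNth-upTouching₁ j _ xs lt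
downsAt₀-flipNth-upTouching₁ j -[1+ _ ]        (false ∷ xs) lt = downsAt₀-flipNth-upTouching₁ j _ xs lt

g-flips : ∀ {n} (x : Path n) → 0 < downsAt (+ 1) (+ 0) x → d (+ 0) x < countFrom downTouching₀ (+ 0) x
g-flips x hasDown₁ = subst (d (+ 0) x <_) (sym (downTouching₀-split (+ 0) x)) (m<m+n _ hasDown₁)

ups-g : ∀ {n} (x : Path n) → 0 < downsAt (+ 1) (+ 0) x → ups (g x) ≡ suc (ups x)
ups-g x hasDown₁ = ups-flipNth-down downTouching₀ (λ _ → refl) _ (+ 0) x (g-flips x hasDown₁)

h′∘g : ∀ {n} (x : Path n) → endHeight (+ 0) x ≡ + 0 → 0 < downsAt (+ 1) (+ 0) x → h′ (g x) ≡ x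
h′∘g x end≡0 hasDown₁ = begin
  flipNth upTouching₁ (u (+ 1) (g x)) (+ 0) (g x)
    ≡⟨ cong (λ q → flipNth upTouching₁ q (+ 0) (g x)) u₁[gx]≡before ⟩
  flipNth upTouching₁ before (+ 0) (g x)
    ≡⟨ flipNth-inverse downTouching₀ upTouching₁ swap j (+ 0) x (g-flips x hasDown₁) ⟩
  x ∎
  where
  open ≡-Reasoning
  j = d (+ 0) x
  before = countBefore downTouching₀ upTouching₁ j (+ 0) x
  swap : ∀ h s → downTouching₀ h s ≡ true → upTouching₁ h (not s) ≡ true
  swap (+ 0) false _ = refl
  swap (+ 1) false _ = refl
  u₁[gx]≡before : u (+ 1) (g x) ≡ before
  u₁[gx]≡before = +-cancelˡ-≡ j _ _ (suc-injective (begin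
    suc (j + u (+ 1) (g x))
      ≡⟨ upsAt₁-flipNth-downTouching₀ j (+ 0) x (g-flips x hasDown₁) ⟩
    before + j + 𝟙[ + 0 ≤ endHeight (+ 0) x ] + 0
      ≡⟨ cong (λ e → before + j + 𝟙[ + 0 ≤ e ] + 0) end≡0 ⟩
    before + j + 1 + 0
      ≡⟨ rearrange before j ⟩
    suc (j + before) ∎))
    where rearrange : ∀ a b → a + b + 1 + 0 ≡ suc (b + a)
          rearrange = ℕ-Solver.solve-∀

h′-flips : ∀ {n} (y : Path n) → endHeight (+ 0) y ≡ + 2 → u (+ 1) y < countFrom upTouching₁ (+ 0) y
h′-flips y end≡2 = subst (u (+ 1) y <_) (sym (upTouching₁-split (+ 0) y)) (m<n+m _ hasUp₀)
  where
  hasUp₀ : 0 < upsAt (+ 0) (+ 0) y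
  hasUp₀ = subst (0 <_) (sym (trans (crossing₀₁ (+ 0) y) (cong (λ e → down₁ + 𝟙[ + 1 ≤ e ]) end≡2)))
                 (≤-trans (s≤s z≤n) (m≤n+m 1 down₁))
    where down₁ = downsAt (+ 1) (+ 0) y

ups-h′ : ∀ {n} (y : Path n) → endHeight (+ 0) y ≡ + 2 → suc (ups (h′ y)) ≡ ups y
ups-h′ y end≡2 = ups-flipNth-up upTouching₁ (λ _ → refl) _ (+ 0) y (h′-flips y end≡2)

g∘h′ : ∀ {n} (y : Path n) → endHeight (+ 0) y ≡ + 2 → g (h′ y) ≡ y
g∘h′ y end≡2 = begin
  flipNth downTouching₀ (d (+ 0) (h′ y)) (+ 0) (h′ y)
    ≡⟨ cong (λ q → flipNth downTouching₀ q (+ 0) (h′ y)) d₀[h′y]≡before ⟩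
  flipNth downTouching₀ before (+ 0) (h′ y)
    ≡⟨ flipNth-inverse upTouching₁ downTouching₀ swap j (+ 0) y (h′-flips y end≡2) ⟩
  y ∎
  where
  open ≡-Reasoning
  j = u (+ 1) y
  before = countBefore upTouching₁ downTouching₀ j (+ 0) y
  swap : ∀ h s → upTouching₁ h s ≡ true → downTouching₀ h (not s) ≡ true
  swap (+ 0) true _ = refl
  swap (+ 1) true _ = refl
  swap -[1+ 0 ]     true ()
  swap -[1+ suc _ ] true ()
  d₀ = d (+ 0) (h′ y)
  d₀[h′y]≡before : d₀ ≡ before
  d₀[h′y]≡before = +-cancelˡ-≡ j _ _ (suc-injective (begin
    suc (j + d₀)
      ≡⟨ rearrange j d₀ ⟩
    j + d₀ + 1 + 0
      ≡⟨ cong (λ e → j + d₀ + 𝟙[ + 2 ≤ e ] + 0) end≡2 ⟨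
    j + d₀ + 𝟙[ + 2 ≤ endHeight (+ 0) y ] + 0
      ≡⟨ downsAt₀-flipNth-upTouching₁ j (+ 0) y (h′-flips y end≡2) ⟩
    suc (before + j)
      ≡⟨ cong suc (+-comm before j) ⟩
    suc (j + before) ∎))
    where rearrange : ∀ a b → suc (a + b) ≡ a + b + 1 + 0
          rearrange = ℕ-Solver.solve-∀

-- Otherwise g would flip nothing in h′ y, and g ∘ h′ = id would give y = h′ y.
h′-downAt₁ : ∀ {n} (y : Path n) → endHeight (+ 0) y ≡ + 2 → 0 < downsAt (+ 1) (+ 0) (h′ y)
h′-downAt₁ y end≡2 with downsAt (+ 1) (+ 0) (h′ y) in noDown₁
... | suc _ = s≤s z≤n
... | zero  = ⊥-elim (1+n≢n (trans (ups-h′ y end≡2) (cong ups y≡h′y)))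
  where
  y≡h′y : y ≡ h′ y
  y≡h′y = trans (sym (g∘h′ y end≡2)) (flipNth-beyond downTouching₀ _ (+ 0) (h′ y) (≤-reflexive noFlip))
    where
    noFlip : countFrom downTouching₀ (+ 0) (h′ y) ≡ d (+ 0) (h′ y)
    noFlip = trans (downTouching₀-split (+ 0) (h′ y))
                   (trans (cong (_+_ (d (+ 0) (h′ y))) noDown₁) (+-identityʳ _))

downs≡k : ∀ k (x : Path (k + k)) → ups x ≡ k → downs x ≡ k
downs≡k k x ups≡k = +-cancelˡ-≡ k _ _ (trans (cong (_+ downs x) (sym ups≡k)) (ups+downs≡length x))

endHeight≡0 : ∀ k (x : Path (k + k)) → ups x ≡ k → endHeight (+ 0) x ≡ + 0
endHeight≡0 k x ups≡k = endHeight-balanced 0 x (trans ups≡k (sym (downs≡k k x ups≡k)))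

endHeight≡2 : ∀ k (y : Path (k + k)) → ups y ≡ suc k → endHeight (+ 0) y ≡ + 2
endHeight≡2 k y ups≡1+k = endHeight-balanced 2 y (trans ups≡1+k (cong suc (sym 1+downs≡k)))
  where
  1+downs≡k : suc (downs y) ≡ k
  1+downs≡k = +-cancelˡ-≡ k _ _
    (trans (+-suc k (downs y)) (trans (cong (_+ downs y) (sym ups≡1+k)) (ups+downs≡length y)))

downsAt₁-positive : ∀ {n} (x : Path n) → endHeight (+ 0) x ≡ + 0 →
  downsBelow (+ 0) (+ 0) x ≢ downs x → 0 < downsAt (+ 1) (+ 0) x
downsAt₁-positive x end≡0 notAllBelow with downsAt (+ 1) (+ 0) x in noDown₁
... | suc _ = s≤s z≤n
... | zero  = ⊥-elim (notAllBelow (downsBelow₀≡downs (+ 0) x refl (cong 𝟙[ + 1 ≤_] end≡0) noDown₁))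

downsBelow₀<downs : ∀ {n} (x : Path n) → 0 < downsAt (+ 1) (+ 0) x → downsBelow (+ 0) (+ 0) x < downs x
downsBelow₀<downs x hasDown₁ = <-≤-trans (m<m+n _ hasDown₁) (downsBelow₀+downsAt₁≤downs (+ 0) x)

lemma6 : (k : ℕ) → 1 ≤ k →
    ((x : Path (k + k)) → L (k + k) k x → ¬ D k k x → L (k + k) (suc k) (g x))
    × ((y : Path (k + k)) → L (k + k) (suc k) y → L (k + k) k (h′ y) × ¬ D k k (h′ y))
    × ((x : Path (k + k)) → L (k + k) k x → ¬ D k k x → h′ (g x) ≡ x)
    × ((y : Path (k + k)) → L (k + k) (suc k) y → g (h′ y) ≡ y)
lemma6 k _ =
    (λ x ups≡k ¬D → trans (ups-g x (hasDown₁ x ups≡k ¬D)) (cong suc ups≡k))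
  , (λ y ups≡1+k → ups[h′y]≡k y ups≡1+k , h′y∉D y ups≡1+k)
  , (λ x ups≡k ¬D → h′∘g x (endHeight≡0 k x ups≡k) (hasDown₁ x ups≡k ¬D))
  , (λ y ups≡1+k → g∘h′ y (endHeight≡2 k y ups≡1+k))
  where
  hasDown₁ : (x : Path (k + k)) → ups x ≡ k → ¬ D k k x → 0 < downsAt (+ 1) (+ 0) x
  hasDown₁ x ups≡k ¬D = downsAt₁-positive x (endHeight≡0 k x ups≡k)
    (λ allBelow → ¬D (ups≡k , trans allBelow (downs≡k k x ups≡k)))

  ups[h′y]≡k : (y : Path (k + k)) → ups y ≡ suc k → ups (h′ y) ≡ k
  ups[h′y]≡k y ups≡1+k = suc-injective (trans (ups-h′ y (endHeight≡2 k y ups≡1+k)) ups≡1+k)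

  h′y∉D : (y : Path (k + k)) → ups y ≡ suc k → ¬ D k k (h′ y)
  h′y∉D y ups≡1+k (_ , below≡k) =
    <-irrefl (trans below≡k (sym (downs≡k k (h′ y) (ups[h′y]≡k y ups≡1+k))))
             (downsBelow₀<downs (h′ y) (h′-downAt₁ y (endHeight≡2 k y ups≡1+k)))
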